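{- Let $G,H$ be finite undirected graphs (possibly with loops and multi-edges) in which every node has degree at least $2$, and let $\mathbf{v}$ be an eigenvector of the non-backtracking matrix of $G$ with eigenvalue $\lambda$, $|\lambda|=1$. Let $N=N(G,\mathbf{v})=\{k\in V(G): \sum_{e:\,t(e)=k}\mathbf{v}_e=0\}$. Let $\sim$ be an equivalence relation on the disjoint union $V(G)\sqcup V(H)$ each of whose classes either is a singleton or consists of exactly one node of $N$ and one node of $V(H)$, and let $X$ be the graph with node set $(V(G)\sqcup V(H))/\!\sim$ and edge set $E(G)\sqcup E(H)$, each edge keeping its endpoints, now replaced by their equivalence classes. Then $\lambda$ is an eigenvalue of the non-backtracking matrix of $X$, with an eigenvector $\mathbf{u}$ that equals $\mathbf{v}$ on the oriented edges coming from $E(G)$ and equals $0$ on the oriented edges coming from $E(H)$.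
   Context: Each edge with endpoints $u,v$ (possibly $u=v$) yields two oriented edges; for an oriented edge $e$ write $s(e),t(e)$ for its source and target and $\bar e$ for the opposite orientation of the same edge. The non-backtracking matrix $\mathbf{B}$ of a graph is indexed by oriented edges with $\mathbf{B}_{f,e}=1$ if $t(e)=s(f)$ and $f\neq\bar e$, and $0$ otherwise. Degrees count a loop twice. -}

module Defs where

open import Level using (Level)
open import Data.Nat as ℕ using (ℕ; zero; suc)
open import Data.Fin as Fin using (Fin; _↑ˡ_; _↑ʳ_; splitAt)
open import Data.Fin.Properties as FinP using ()
open import Data.Bool using (Bool; true; false; not; if_then_else_; _∧_)
open import Data.Bool.Properties as BoolP using ()
open import Data.Product using (Σ; _×_; _,_; proj₁; proj₂)
open import Data.Product.Properties using (≡-dec)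
open import Data.Sum using (_⊎_; inj₁; inj₂; [_,_]′)
open import Data.List using (List; map; allFin)
open import Data.Nat.ListAction using (sum)
open import Relation.Nullary using (¬_)
open import Relation.Nullary.Decidable using (⌊_⌋)
open import Relation.Binary.PropositionalEquality using (_≡_)
open import Algebra.Bundles using (CommutativeRing)

record Graph : Set where
  field
    nV : ℕ
    nE : ℕ
    ends : Fin nE → Fin nV × Fin nV
open Graph public

-- Oriented edges: (e , true) goes from the first endpoint to the second,
-- (e , false) is the opposite orientation. A loop gives two distinct
-- oriented edges.
OE : Graph → Set
OE G = Fin (nE G) × Bool

src : (G : Graph) → OE G → Fin (nV G)
src G (e , true)  = proj₁ (ends G e)
src G (e , false) = proj₂ (ends G e)

tgt : (G : Graph) → OE G → Fin (nV G)
tgt G (e , true)  = proj₂ (ends G e)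
tgt G (e , false) = proj₁ (ends G e)

rev : (G : Graph) → OE G → OE G
rev G (e , b) = (e , not b)

_≟OE_ : {G : Graph} → (f e : OE G) → Relation.Nullary.Dec (f ≡ e)
_≟OE_ = ≡-dec FinP._≟_ BoolP._≟_

-- degree of a node = number of oriented edges with source k
-- (a loop is counted twice)
degree : (G : Graph) → Fin (nV G) → ℕ
degree G k = sum (map (λ e → ind (proj₁ (ends G e)) ℕ.+ ind (proj₂ (ends G e))) (allFin (nE G)))
  where
  ind : Fin (nV G) → ℕ
  ind x = if ⌊ x FinP.≟ k ⌋ then 1 else 0

-- Gluing: X has node set Fin nX (the quotient, given by the map q),
-- edge set E(G) ⊎ E(H) encoded as Fin (nE G + nE H), endpoints mapped by q.
glue : (G H : Graph) (nX : ℕ) → (Fin (nV G) ⊎ Fin (nV H) → Fin nX) → Graph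
glue G H nX q = record
  { nV = nX
  ; nE = nE G ℕ.+ nE H
  ; ends = λ i → [ (λ e → q (inj₁ (proj₁ (ends G e))) , q (inj₁ (proj₂ (ends G e))))
                 , (λ e → q (inj₂ (proj₁ (ends H e))) , q (inj₂ (proj₂ (ends H e)))) ]′
                 (splitAt (nE G) i)
  }

embG : (G H : Graph) → Fin (nE G) → Fin (nE G ℕ.+ nE H)
embG G H e = e ↑ˡ nE H

embH : (G H : Graph) → Fin (nE H) → Fin (nE G ℕ.+ nE H)
embH G H e = nE G ↑ʳ e

module _ {c ℓ : Level} (R : CommutativeRing c ℓ) where
  open CommutativeRing R

  ΣR : {n : ℕ} → (Fin n → Carrier) → Carrier
  ΣR {zero}  f = 0#
  ΣR {suc n} f = f Fin.zero + ΣR (λ i → f (Fin.suc i))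

  ΣOE : (G : Graph) → (OE G → Carrier) → Carrier
  ΣOE G f = ΣR (λ i → f (i , true) + f (i , false))

  NB : (G : Graph) → OE G → OE G → Carrier
  NB G f e = if ⌊ tgt G e FinP.≟ src G f ⌋ ∧ not ⌊ _≟OE_ {G} f (rev G e) ⌋ then 1# else 0#

  NBapply : (G : Graph) → (OE G → Carrier) → OE G → Carrier
  NBapply G v f = ΣOE G (λ e → NB G f e * v e)

  IsNBEigenvector : (G : Graph) → Carrier → (OE G → Carrier) → Set ℓ
  IsNBEigenvector G λ' v =
    (Σ (OE G) λ e → ¬ (v e ≈ 0#)) × (∀ f → NBapply G v f ≈ λ' * v f)

  inflow : (G : Graph) → (OE G → Carrier) → Fin (nV G) → Carrier
  inflow G v k = ΣOE G (λ e → if ⌊ tgt G e FinP.≟ k ⌋ then v e else 0#)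

  InN : (G : Graph) → (OE G → Carrier) → Fin (nV G) → Set ℓ
  InN G v k = inflow G v k ≈ 0#

module Submission where

open import Defs
open import Level using (Level)
open import Data.Nat as ℕ using (ℕ; _≤_)
open import Data.Fin using (Fin; _↑ˡ_; _↑ʳ_; splitAt)
import Data.Fin.Properties as FinP
open import Data.Bool using (Bool; true; false; not; if_then_else_; _∧_)
open import Data.Bool.Properties using (∧-identityʳ)
open import Data.Product using (Σ; _×_; _,_; proj₁; proj₂)
open import Data.Sum using (_⊎_; inj₁; inj₂; [_,_]′)
open import Data.Sum.Properties using (inj₁-injective)
open import Function using (_∘′_)
open import Relation.Nullary using (Dec; yes; no; ¬_)
open import Relation.Nullary.Decidable using (⌊_⌋; isYes≗does; does-⇔; dec-false)
open import Relation.Binary.PropositionalEquality as ≡ using (_≡_; _≢_)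
open import Relation.Binary.Structures using (IsEquivalence)
open import Function.Bundles using (_⇔_; mk⇔; Equivalence)
open import Algebra.Bundles using (CommutativeRing)
import Relation.Binary.Reasoning.Setoid as SetoidReasoning

-- At an
-- oriented edge leaving a node of G nothing changed: q is injective on V(G), so
-- the non-backtracking rows of G and X agree there and H contributes only zeros.
-- At an oriented edge leaving a node h of H, (B u)_f collects the values of v on
-- the oriented G-edges pointing into h; these are the edges pointing into the
-- G-node k glued to h, and their sum vanishes because k ∈ N (if no such k
-- exists the sum is empty).

⌊⌋-⇔ : ∀ {a b} {A : Set a} {B : Set b} → A ⇔ B → (a? : Dec A) (b? : Dec B) → ⌊ a? ⌋ ≡ ⌊ b? ⌋
⌊⌋-⇔ A⇔B a? b? = ≡.trans (isYes≗does a?) (≡.trans (does-⇔ A⇔B a? b?) (≡.sym (isYes≗does b?)))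

⌊⌋-false : ∀ {a} {A : Set a} (a? : Dec A) → ¬ A → ⌊ a? ⌋ ≡ false
⌊⌋-false a? ¬a = ≡.trans (isYes≗does a?) (dec-false a? ¬a)

module Sums {c ℓ : Level} (R : CommutativeRing c ℓ) where
  open CommutativeRing R

  ΣR-cong : ∀ {n} {f g : Fin n → Carrier} → (∀ i → f i ≈ g i) → ΣR R f ≈ ΣR R g
  ΣR-cong {ℕ.zero}  f≈g = refl
  ΣR-cong {ℕ.suc n} f≈g = +-cong (f≈g Fin.zero) (ΣR-cong (λ i → f≈g (Fin.suc i)))

  ΣR-zero : ∀ {n} {f : Fin n → Carrier} → (∀ i → f i ≈ 0#) → ΣR R f ≈ 0#
  ΣR-zero {ℕ.zero}  f≈0 = refl
  ΣR-zero {ℕ.suc n} f≈0 =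
    trans (+-cong (f≈0 Fin.zero) (ΣR-zero (λ i → f≈0 (Fin.suc i)))) (+-identityˡ 0#)

  ΣR-↑ : ∀ m n (f : Fin (m ℕ.+ n) → Carrier) →
    ΣR R f ≈ ΣR R (λ i → f (i ↑ˡ n)) + ΣR R (λ j → f (m ↑ʳ j))
  ΣR-↑ ℕ.zero    n f = sym (+-identityˡ _)
  ΣR-↑ (ℕ.suc m) n f =
    trans (+-cong refl (ΣR-↑ m n (λ i → f (Fin.suc i)))) (sym (+-assoc _ _ _))

  ΣOE-cong : ∀ G {f g : OE G → Carrier} → (∀ e → f e ≈ g e) → ΣOE R G f ≈ ΣOE R G g
  ΣOE-cong G f≈g = ΣR-cong (λ i → +-cong (f≈g (i , true)) (f≈g (i , false)))

  ΣOE-zero : ∀ G {f : OE G → Carrier} → (∀ e → f e ≈ 0#) → ΣOE R G f ≈ 0#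
  ΣOE-zero G f≈0 = ΣR-zero (λ i → trans (+-cong (f≈0 (i , true)) (f≈0 (i , false))) (+-identityˡ 0#))

  if-1-0-* : ∀ b x → (if b then 1# else 0#) * x ≈ (if b then x else 0#)
  if-1-0-* true  x = *-identityˡ x
  if-1-0-* false x = zeroˡ x

module Gluing {c ℓ : Level} (R : CommutativeRing c ℓ) (G H : Graph)
  (nX : ℕ) (q : Fin (nV G) ⊎ Fin (nV H) → Fin nX) where
  open CommutativeRing R
  open Sums R

  X : Graph
  X = glue G H nX q

  ιG : OE G → OE X
  ιG (e , b) = embG G H e , b

  ιH : OE H → OE X
  ιH (e , b) = embH G H e , b

  ιG-injective : ∀ {f e} → ιG f ≡ ιG e → f ≡ e
  ιG-injective {_ , _} {_ , _} p =
    ≡.cong₂ _,_ (FinP.↑ˡ-injective (nE H) _ _ (≡.cong proj₁ p)) (≡.cong proj₂ p)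

  ιH≢ιG : ∀ f e → ιH f ≢ ιG e
  ιH≢ιG (f , _) (e , _) p with ≡.trans (≡.sym (FinP.splitAt-↑ʳ (nE G) (nE H) f))
    (≡.trans (≡.cong (splitAt (nE G) ∘′ proj₁) p) (FinP.splitAt-↑ˡ (nE G) e (nE H)))
  ... | ()

  OE-glue-view : ∀ f → (Σ (OE G) λ e → ιG e ≡ f) ⊎ (Σ (OE H) λ e → ιH e ≡ f)
  OE-glue-view (i , b) with splitAt (nE G) i in eq
  ... | inj₁ e = inj₁ ((e , b) , ≡.cong (_, b) (FinP.splitAt⁻¹-↑ˡ eq))
  ... | inj₂ e = inj₂ ((e , b) , ≡.cong (_, b) (FinP.splitAt⁻¹-↑ʳ eq))

  ends-embG : ∀ e → ends X (embG G H e) ≡ (q (inj₁ (proj₁ (ends G e))) , q (inj₁ (proj₂ (ends G e))))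
  ends-embG e rewrite FinP.splitAt-↑ˡ (nE G) e (nE H) = ≡.refl

  ends-embH : ∀ e → ends X (embH G H e) ≡ (q (inj₂ (proj₁ (ends H e))) , q (inj₂ (proj₂ (ends H e))))
  ends-embH e rewrite FinP.splitAt-↑ʳ (nE G) (nE H) e = ≡.refl

  src-ιG : ∀ e → src X (ιG e) ≡ q (inj₁ (src G e))
  src-ιG (e , true)  = ≡.cong proj₁ (ends-embG e)
  src-ιG (e , false) = ≡.cong proj₂ (ends-embG e)

  tgt-ιG : ∀ e → tgt X (ιG e) ≡ q (inj₁ (tgt G e))
  tgt-ιG (e , true)  = ≡.cong proj₂ (ends-embG e)
  tgt-ιG (e , false) = ≡.cong proj₁ (ends-embG e)

  src-ιH : ∀ e → src X (ιH e) ≡ q (inj₂ (src H e))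
  src-ιH (e , true)  = ≡.cong proj₁ (ends-embH e)
  src-ιH (e , false) = ≡.cong proj₂ (ends-embH e)

  NB-ιG-ιG : (∀ {a b} → q (inj₁ a) ≡ q (inj₁ b) → a ≡ b) →
    ∀ f e → NB R X (ιG f) (ιG e) ≡ NB R G f e
  NB-ιG-ιG q-inj f (e , b) = ≡.cong (λ t → if t then 1# else 0#) (≡.cong₂ _∧_ meets (≡.cong not backtracks))
    where
    meets : ⌊ tgt X (ιG (e , b)) FinP.≟ src X (ιG f) ⌋ ≡ ⌊ tgt G (e , b) FinP.≟ src G f ⌋
    meets = ⌊⌋-⇔ (mk⇔ (λ p → q-inj (≡.trans (≡.sym (tgt-ιG (e , b))) (≡.trans p (src-ιG f))))
                       (λ p → ≡.trans (tgt-ιG (e , b)) (≡.trans (≡.cong (q ∘′ inj₁) p) (≡.sym (src-ιG f)))))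
                 _ _
    backtracks : ⌊ _≟OE_ {X} (ιG f) (ιG (e , not b)) ⌋ ≡ ⌊ _≟OE_ {G} f (e , not b) ⌋
    backtracks = ⌊⌋-⇔ (mk⇔ ιG-injective (≡.cong ιG)) _ _

  NB-ιH-ιG : ∀ f e →
    NB R X (ιH f) (ιG e) ≡ (if ⌊ q (inj₁ (tgt G e)) FinP.≟ q (inj₂ (src H f)) ⌋ then 1# else 0#)
  NB-ιH-ιG f (e , b) = ≡.cong (λ t → if t then 1# else 0#) (begin
      meets ∧ not ⌊ _≟OE_ {X} (ιH f) (ιG (e , not b)) ⌋
    ≡⟨ ≡.cong (λ t → meets ∧ not t) (⌊⌋-false _ (ιH≢ιG f (e , not b))) ⟩
      meets ∧ true
    ≡⟨ ∧-identityʳ meets ⟩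
      meets
    ≡⟨ ⌊⌋-⇔ (mk⇔ (λ p → ≡.trans (≡.sym (tgt-ιG (e , b))) (≡.trans p (src-ιH f)))
                 (λ p → ≡.trans (tgt-ιG (e , b)) (≡.trans p (≡.sym (src-ιH f))))) _ _ ⟩
      ⌊ q (inj₁ (tgt G (e , b))) FinP.≟ q (inj₂ (src H f)) ⌋
    ∎)
    where
    open ≡.≡-Reasoning
    meets : Bool
    meets = ⌊ tgt X (ιG (e , b)) FinP.≟ src X (ιH f) ⌋

  ΣOE-glue : ∀ w → ΣOE R X w ≈ ΣOE R G (w ∘′ ιG) + ΣOE R H (w ∘′ ιH)
  ΣOE-glue w = ΣR-↑ (nE G) (nE H) _

  extendByZero : (OE G → Carrier) → OE X → Carrier
  extendByZero v (i , b) = [ (λ e → v (e , b)) , (λ _ → 0#) ]′ (splitAt (nE G) i)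

  extendByZero-ιG : ∀ v e → extendByZero v (ιG e) ≡ v e
  extendByZero-ιG v (e , b) rewrite FinP.splitAt-↑ˡ (nE G) e (nE H) = ≡.refl

  extendByZero-ιH : ∀ v e → extendByZero v (ιH e) ≡ 0#
  extendByZero-ιH v (e , b) rewrite FinP.splitAt-↑ʳ (nE G) (nE H) e = ≡.refl

  NBapply-extendByZero : ∀ v f → NBapply R X (extendByZero v) f ≈ ΣOE R G (λ e → NB R X f (ιG e) * v e)
  NBapply-extendByZero v f = begin
    NBapply R X (extendByZero v) f
      ≈⟨ ΣOE-glue (λ e → NB R X f e * u e) ⟩
    ΣOE R G (λ e → NB R X f (ιG e) * u (ιG e)) + ΣOE R H (λ e → NB R X f (ιH e) * u (ιH e))
      ≈⟨ +-cong (ΣOE-cong G G-term) (ΣOE-zero H H-term) ⟩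
    ΣOE R G (λ e → NB R X f (ιG e) * v e) + 0#
      ≈⟨ +-identityʳ _ ⟩
    ΣOE R G (λ e → NB R X f (ιG e) * v e) ∎
    where
    open SetoidReasoning setoid
    u : OE X → Carrier
    u = extendByZero v
    G-term : ∀ e → NB R X f (ιG e) * u (ιG e) ≈ NB R X f (ιG e) * v e
    G-term e = *-congˡ (reflexive (extendByZero-ιG v e))
    H-term : ∀ e → NB R X f (ιH e) * u (ιH e) ≈ 0#
    H-term e = trans (*-congˡ (reflexive (extendByZero-ιH v e))) (zeroʳ _)

  module _ (v : OE G → Carrier)
    (q-inj : ∀ {a b} → q (inj₁ a) ≡ q (inj₁ b) → a ≡ b)
    (glued∈N : ∀ {k h} → q (inj₁ k) ≡ q (inj₂ h) → InN R G v k) where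

    NBapply-extendByZero-ιG : ∀ f → NBapply R X (extendByZero v) (ιG f) ≈ NBapply R G v f
    NBapply-extendByZero-ιG f = trans (NBapply-extendByZero v (ιG f)) (ΣOE-cong G term)
      where
      term : ∀ e → NB R X (ιG f) (ιG e) * v e ≈ NB R G f e * v e
      term e = *-congʳ (reflexive (NB-ιG-ιG q-inj f e))

    G-inflow-into-q-inj₂≈0 : ∀ h → ΣOE R G (λ e → if ⌊ q (inj₁ (tgt G e)) FinP.≟ q (inj₂ h) ⌋ then v e else 0#) ≈ 0#
    G-inflow-into-q-inj₂≈0 h with FinP.any? (λ k → q (inj₁ k) FinP.≟ q (inj₂ h))
    ... | yes (k , qk≡qh) = trans (ΣOE-cong G term) (glued∈N qk≡qh)
      where
      into-k : ∀ e → ⌊ q (inj₁ (tgt G e)) FinP.≟ q (inj₂ h) ⌋ ≡ ⌊ tgt G e FinP.≟ k ⌋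
      into-k e = ⌊⌋-⇔ (mk⇔ (λ p → q-inj (≡.trans p (≡.sym qk≡qh)))
                           (λ p → ≡.trans (≡.cong (q ∘′ inj₁) p) qk≡qh)) _ _
      term : ∀ e → (if ⌊ q (inj₁ (tgt G e)) FinP.≟ q (inj₂ h) ⌋ then v e else 0#)
                 ≈ (if ⌊ tgt G e FinP.≟ k ⌋ then v e else 0#)
      term e = reflexive (≡.cong (λ t → if t then v e else 0#) (into-k e))
    ... | no ¬glued = ΣOE-zero G term
      where
      term : ∀ e → (if ⌊ q (inj₁ (tgt G e)) FinP.≟ q (inj₂ h) ⌋ then v e else 0#) ≈ 0#
      term e = reflexive (≡.cong (λ t → if t then v e else 0#) (⌊⌋-false _ (λ p → ¬glued (_ , p))))

    NBapply-extendByZero-ιH : ∀ f → NBapply R X (extendByZero v) (ιH f) ≈ 0#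
    NBapply-extendByZero-ιH f = trans (NBapply-extendByZero v (ιH f))
      (trans (ΣOE-cong G term) (G-inflow-into-q-inj₂≈0 (src H f)))
      where
      term : ∀ e → NB R X (ιH f) (ιG e) * v e
                 ≈ (if ⌊ q (inj₁ (tgt G e)) FinP.≟ q (inj₂ (src H f)) ⌋ then v e else 0#)
      term e = trans (*-congʳ (reflexive (NB-ιH-ιG f e))) (if-1-0-* _ _)

    extendByZero-isNBEigenvector : ∀ {λ'} → IsNBEigenvector R G λ' v → IsNBEigenvector R X λ' (extendByZero v)
    extendByZero-isNBEigenvector {λ'} ((e , ve≉0) , Bv≈λv) = (ιG e , ue≉0) , Bu≈λu
      where
      ue≉0 : ¬ (extendByZero v (ιG e) ≈ 0#)
      ue≉0 p = ve≉0 (trans (reflexive (≡.sym (extendByZero-ιG v e))) p)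
      Bu≈λu : ∀ f → NBapply R X (extendByZero v) f ≈ λ' * extendByZero v f
      Bu≈λu f with OE-glue-view f
      ... | inj₁ (f , ≡.refl) = begin
        NBapply R X (extendByZero v) (ιG f) ≈⟨ NBapply-extendByZero-ιG f ⟩
        NBapply R G v f                     ≈⟨ Bv≈λv f ⟩
        λ' * v f                            ≈⟨ *-congˡ (reflexive (≡.sym (extendByZero-ιG v f))) ⟩
        λ' * extendByZero v (ιG f)          ∎
        where open SetoidReasoning setoid
      ... | inj₂ (f , ≡.refl) = begin
        NBapply R X (extendByZero v) (ιH f) ≈⟨ NBapply-extendByZero-ιH f ⟩
        0#                                  ≈⟨ sym (zeroʳ λ') ⟩
        λ' * 0#                             ≈⟨ *-congˡ (reflexive (≡.sym (extendByZero-ιH v f))) ⟩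
        λ' * extendByZero v (ιH f)          ∎
        where open SetoidReasoning setoid

theorem6p2 : ∀ {c ℓ p r : Level} (R : CommutativeRing c ℓ)
    (AbsOne : CommutativeRing.Carrier R → Set p)
    (G H : Graph)
    → (∀ k → 2 ≤ degree G k) → (∀ k → 2 ≤ degree H k)
    → (v : OE G → CommutativeRing.Carrier R) (λ' : CommutativeRing.Carrier R)
    → IsNBEigenvector R G λ' v → AbsOne λ'
    → (_∼_ : Fin (nV G) ⊎ Fin (nV H) → Fin (nV G) ⊎ Fin (nV H) → Set r)
    → IsEquivalence _∼_
    → (∀ x y → x ∼ y → x ≡ y ⊎ Σ (Fin (nV G)) λ k → Σ (Fin (nV H)) λ h →
         InN R G v k × ((x ≡ inj₁ k × y ≡ inj₂ h) ⊎ (x ≡ inj₂ h × y ≡ inj₁ k)))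
    → (nX : ℕ) (q : Fin (nV G) ⊎ Fin (nV H) → Fin nX)
    → (∀ y → Σ (Fin (nV G) ⊎ Fin (nV H)) λ x → q x ≡ y)
    → (∀ x y → (q x ≡ q y) ⇔ (x ∼ y))
    → Σ (OE (glue G H nX q) → CommutativeRing.Carrier R) λ u →
        IsNBEigenvector R (glue G H nX q) λ' u
        × (∀ e b → CommutativeRing._≈_ R (u (embG G H e , b)) (v (e , b)))
        × (∀ e b → CommutativeRing._≈_ R (u (embH G H e , b)) (CommutativeRing.0# R))
theorem6p2 R _ G H _ _ v _ v-eigen _ _∼_ _ classes nX q _ q≡⇔∼ =
  extendByZero v ,
  extendByZero-isNBEigenvector v q-inj glued∈N v-eigen ,
  (λ e b → reflexive (extendByZero-ιG v (e , b))) ,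
  (λ e b → reflexive (extendByZero-ιH v (e , b)))
  where
  open CommutativeRing R using (reflexive)
  open Gluing R G H nX q

  q-inj : ∀ {a b} → q (inj₁ a) ≡ q (inj₁ b) → a ≡ b
  q-inj p with classes _ _ (Equivalence.to (q≡⇔∼ _ _) p)
  ... | inj₁ a≡b = inj₁-injective a≡b
  ... | inj₂ (_ , _ , _ , inj₁ (_ , ()))
  ... | inj₂ (_ , _ , _ , inj₂ (() , _))

  glued∈N : ∀ {k h} → q (inj₁ k) ≡ q (inj₂ h) → InN R G v k
  glued∈N p with classes _ _ (Equivalence.to (q≡⇔∼ _ _) p)
  ... | inj₁ ()
  ... | inj₂ (_ , _ , k∈N , inj₁ (≡.refl , _)) = k∈N
  ... | inj₂ (_ , _ , _ , inj₂ (() , _))
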